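{- Let $a, b$ be integers with $3 \leq a \leq b$. Then $\mathcal{G}_{\mathcal{E}}(a,b) \geq b - 2a + 1$.
   Context: A position is an unordered pair $(a,b)$ of nonnegative integers (pile sizes). $\mathcal{E}$-Wythoff: a move either removes a positive number of tokens from one pile, or removes the same positive number of tokens from both piles, or removes $k$ tokens from the smaller pile (or from either pile if the piles are equal) and $l$ tokens from the other pile, for integers $k \geq 1$, $l\ge 0$ with $l < k$. $\mathcal{G}_{\mathcal{E}}$ is its Sprague-Grundy function: $\mathcal{G}_{\mathcal{E}}(p)=\mathrm{mex}\{\mathcal{G}_{\mathcal{E}}(q): q \text{ reachable from } p \text{ in one move}\}$, where $\mathrm{mex}(S)$ is the least nonnegative integer not in $S$ and $\mathrm{mex}\{\}=0$. -}

module Defs where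

open import Data.Nat using (ℕ; zero; suc; _+_; _∸_; _⊔_; _⊓_; _≡ᵇ_)
open import Data.Nat.Properties using (_≟_)
open import Data.Bool using (Bool; true; false; if_then_else_)
open import Data.List using (List; []; _∷_; map; _++_; concatMap; upTo; length)
open import Data.Bool.ListAction using (any)
open import Data.Product using (_×_; _,_; proj₁; proj₂)

-- Positions are pairs of pile sizes; the game treats (a , b) and (b , a)
-- alike (the move set below depends only on the unordered pair up to swap).
Pos : Set
Pos = ℕ × ℕ

oneTo : ℕ → List ℕ
oneTo n = map suc (upTo n)

-- All positions reachable in one E-Wythoff move from (a , b).
-- * remove t ≥ 1 tokens from one pile;
-- * remove t ≥ 1 tokens from both piles;
-- * remove k ≥ 1 tokens from the smaller pile s = min a b (either pile if
--   equal; by symmetry the resulting unordered pairs are the same) and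
--   l tokens, 0 ≤ l < k, from the other pile L = max a b.
moves : ℕ → ℕ → List Pos
moves a b =
     map (λ t → (a ∸ t , b)) (oneTo a)
  ++ map (λ t → (a , b ∸ t)) (oneTo b)
  ++ map (λ t → (a ∸ t , b ∸ t)) (oneTo (a ⊓ b))
  ++ concatMap (λ k → map (λ l → ((a ⊓ b) ∸ k , (a ⊔ b) ∸ l)) (upTo k))
               (oneTo (a ⊓ b))

elem : ℕ → List ℕ → Bool
elem n xs = any (λ x → n ≡ᵇ x) xs

mexFrom : ℕ → ℕ → List ℕ → ℕ
mexFrom zero    n xs = n
mexFrom (suc f) n xs = if elem n xs then mexFrom f (suc n) xs else n

-- mex of a finite list: the least natural number not in the list
-- (it is at most length xs, so length xs + 1 search steps suffice).
mex : List ℕ → ℕ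
mex xs = mexFrom (suc (length xs)) 0 xs

-- Fuel-bounded Sprague-Grundy recursion.  Every move decreases a + b by
-- at least 1, so fuel a + b + 1 makes the recursion exact.
grundyF : ℕ → ℕ → ℕ → ℕ
grundyF zero     a b = 0
grundyF (suc f)  a b = mex (map (λ p → grundyF f (proj₁ p) (proj₂ p)) (moves a b))

GE : ℕ → ℕ → ℕ
GE a b = grundyF (suc (a + b)) a b

module Submission where

-- Next,
-- the options of a position (a,j) with a ≤ j are either in row a below j
-- or in a lower row i < a with z ≥ j + i - a.  The rows 0, 1, 2 are
-- computed in closed form (G(0,z) = z, rows 1 and 2 are periodic with
-- period 3), giving z ≤ G(i,z) + i + 1 for i ≤ 2.  The bound is then
-- proved by induction on a + b: if w = G(a,b) and w + 2a ≤ b, put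
-- j = w + 2a - 1 < b.  Induction gives G(a,j) > w, so w is the value of
-- an option of (a,j); it cannot lie in row a (it would be an option of
-- (a,b) too), and in a lower row i it contradicts z ≤ G(i,z) + i + a - 2,
-- which holds by the closed forms for i ≤ 2 and by induction for i ≥ 3.

open import Defs
open import Level using (0ℓ)
open import Data.Nat using (ℕ; zero; suc; _+_; _∸_; _*_; _≤_; _<_; z≤n; s≤s; s≤s⁻¹; _⊓_; _⊔_; _≡ᵇ_; _<?_)
open import Data.Nat.Properties
open import Data.Nat.Induction using (<-rec; <-wellFounded)
open import Data.Nat.Tactic.RingSolver using (solve; solve-∀)
open import Data.Bool using (true; false; T)
open import Data.Unit using (tt)
open import Data.Empty using (⊥; ⊥-elim)
open import Data.List using (List; []; _∷_; map; _++_; upTo; length)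
open import Data.List.Properties using (length-++-sucʳ; map-cong-local)
open import Data.List.Membership.Propositional using (_∈_; _∉_; find; lose)
open import Data.List.Membership.Propositional.Properties
open import Data.List.Relation.Unary.Any using (here; there)
import Data.List.Relation.Unary.All as All
open import Data.Product using (_×_; _,_; proj₁; proj₂; Σ; ∃₂)
open import Data.Sum using (_⊎_; inj₁; inj₂)
open import Induction.WellFounded using (module All)
import Relation.Binary.Construct.On as On
open import Relation.Binary.PropositionalEquality
open import Relation.Binary.Definitions using (tri<; tri≈; tri>)
open import Relation.Nullary using (yes; no)

elem⇒∈ : ∀ n xs → elem n xs ≡ true → n ∈ xs
elem⇒∈ n []       ()
elem⇒∈ n (x ∷ xs) e with n ≡ᵇ x in eq
... | true  = here (≡ᵇ⇒≡ n x (subst T (sym eq) tt))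
... | false = there (elem⇒∈ n xs e)

∈⇒elem : ∀ n xs → n ∈ xs → elem n xs ≡ true
∈⇒elem n (x ∷ xs) (here refl) with n ≡ᵇ n in eq
... | true  = refl
... | false = ⊥-elim (subst T eq (≡⇒≡ᵇ n n refl))
∈⇒elem n (x ∷ xs) (there n∈xs) with n ≡ᵇ x
... | true  = refl
... | false = ∈⇒elem n xs n∈xs

-- Pigeonhole: a list containing 0, 1, ..., n - 1 has at least n entries.
-- It shows that the fuel of `mex` never runs out.
all-below⇒≤length : ∀ n xs → (∀ {k} → k < n → k ∈ xs) → n ≤ length xs
all-below⇒≤length zero    xs below = z≤n
all-below⇒≤length (suc n) xs below with ∈-∃++ (below ≤-refl)
... | ys , zs , refl =
  subst (suc n ≤_) (sym (length-++-sucʳ ys n zs)) (s≤s (all-below⇒≤length n (ys ++ zs) below′))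
  where
  below′ : ∀ {k} → k < n → k ∈ ys ++ zs
  below′ {k} k<n with ∈-++⁻ ys (below (m<n⇒m<1+n k<n))
  ... | inj₁ k∈ys         = ∈-++⁺ˡ k∈ys
  ... | inj₂ (here k≡n)   = ⊥-elim (<⇒≢ k<n k≡n)
  ... | inj₂ (there k∈zs) = ∈-++⁺ʳ ys k∈zs

IsMex : List ℕ → ℕ → Set
IsMex xs m = (∀ {k} → k < m → k ∈ xs) × m ∉ xs

mexFrom-isMex : ∀ f n xs → (∀ {k} → k < n → k ∈ xs) → length xs < n + f →
                IsMex xs (mexFrom f n xs)
mexFrom-isMex zero n xs below short =
  ⊥-elim (<-irrefl refl (≤-<-trans (all-below⇒≤length n xs below) (subst (length xs <_) (+-identityʳ n) short)))
mexFrom-isMex (suc f) n xs below short with elem n xs in eq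
... | true  = mexFrom-isMex f (suc n) xs below′ (subst (length xs <_) (+-suc n f) short)
  where
  below′ : ∀ {k} → k < suc n → k ∈ xs
  below′ {k} k<1+n with m≤n⇒m<n∨m≡n (s≤s⁻¹ k<1+n)
  ... | inj₁ k<n  = below k<n
  ... | inj₂ refl = elem⇒∈ k xs eq
... | false = below , λ n∈xs → subst T (trans (sym (∈⇒elem n xs n∈xs)) eq) tt

mex-isMex : ∀ xs → IsMex xs (mex xs)
mex-isMex xs = mexFrom-isMex (suc (length xs)) 0 xs (λ ()) ≤-refl

data Move (a b : ℕ) : Pos → Set where
  takeˡ : ∀ t → t < a → Move a b (a ∸ suc t , b)
  takeʳ : ∀ t → t < b → Move a b (a , b ∸ suc t)
  takeᵈ : ∀ t → t < a ⊓ b → Move a b (a ∸ suc t , b ∸ suc t)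
  takeᴱ : ∀ k l → k < a ⊓ b → l ≤ k → Move a b ((a ⊓ b) ∸ suc k , (a ⊔ b) ∸ l)

∈oneTo : ∀ {i n} → i < n → suc i ∈ oneTo n
∈oneTo i<n = ∈-map⁺ suc (∈-upTo⁺ i<n)

oneTo-∈ : ∀ {t n} → t ∈ oneTo n → Σ ℕ λ i → i < n × t ≡ suc i
oneTo-∈ t∈ with i , i∈ , t≡ ← ∈-map⁻ suc t∈ = i , ∈-upTo⁻ i∈ , t≡

fromFirst fromSecond fromBoth : ℕ → ℕ → List Pos
fromFirst  a b = map (λ t → (a ∸ t , b)) (oneTo a)
fromSecond a b = map (λ t → (a , b ∸ t)) (oneTo b)
fromBoth   a b = map (λ t → (a ∸ t , b ∸ t)) (oneTo (a ⊓ b))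

move⇒∈ : ∀ {a b p} → Move a b p → p ∈ moves a b
move⇒∈ {a} {b} (takeˡ t t<a) = ∈-++⁺ˡ (∈-map⁺ (λ t → (a ∸ t , b)) (∈oneTo t<a))
move⇒∈ {a} {b} (takeʳ t t<b) = ∈-++⁺ʳ (fromFirst a b) (∈-++⁺ˡ (∈-map⁺ (λ t → (a , b ∸ t)) (∈oneTo t<b)))
move⇒∈ {a} {b} (takeᵈ t t<m) = ∈-++⁺ʳ (fromFirst a b) (∈-++⁺ʳ (fromSecond a b)
  (∈-++⁺ˡ (∈-map⁺ (λ t → (a ∸ t , b ∸ t)) (∈oneTo t<m))))
move⇒∈ {a} {b} (takeᴱ k l k<m l≤k) = ∈-++⁺ʳ (fromFirst a b) (∈-++⁺ʳ (fromSecond a b) (∈-++⁺ʳ (fromBoth a b)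
  (∈-concatMap⁺ (λ k → map (λ l → ((a ⊓ b) ∸ k , (a ⊔ b) ∸ l)) (upTo k))
    (lose (∈oneTo k<m) (∈-map⁺ (λ l → ((a ⊓ b) ∸ suc k , (a ⊔ b) ∸ l)) (∈-upTo⁺ (s≤s l≤k)))))))

∈⇒move : ∀ a b {p} → p ∈ moves a b → Move a b p
∈⇒move a b p∈ with ∈-++⁻ (fromFirst a b) p∈
... | inj₁ q with t , t∈ , refl ← ∈-map⁻ (λ t → (a ∸ t , b)) q
             with i , i<a , refl ← oneTo-∈ t∈ = takeˡ i i<a
∈⇒move a b p∈ | inj₂ p∈₂ with ∈-++⁻ (fromSecond a b) p∈₂
... | inj₁ q with t , t∈ , refl ← ∈-map⁻ (λ t → (a , b ∸ t)) q
             with i , i<b , refl ← oneTo-∈ t∈ = takeʳ i i<b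
∈⇒move a b p∈ | inj₂ p∈₂ | inj₂ p∈₃ with ∈-++⁻ (fromBoth a b) p∈₃
... | inj₁ q with t , t∈ , refl ← ∈-map⁻ (λ t → (a ∸ t , b ∸ t)) q
             with i , i<m , refl ← oneTo-∈ t∈ = takeᵈ i i<m
... | inj₂ q
  with k , k∈ , p∈ₖ ← find (∈-concatMap⁻ (λ k → map (λ l → ((a ⊓ b) ∸ k , (a ⊔ b) ∸ l)) (upTo k))
                                         {xs = oneTo (a ⊓ b)} q)
  with i , i<m , refl ← oneTo-∈ k∈
  with l , l∈ , refl ← ∈-map⁻ (λ l → ((a ⊓ b) ∸ suc i , (a ⊔ b) ∸ l)) {xs = upTo (suc i)} p∈ₖ
  = takeᴱ i l i<m (s≤s⁻¹ (∈-upTo⁻ l∈))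

size : Pos → ℕ
size p = proj₁ p + proj₂ p

∸-suc-< : ∀ {t a} → t < a → a ∸ suc t < a
∸-suc-< {t} {suc a} _ = s≤s (m∸n≤m a t)

min+max : ∀ a b → (a ⊓ b) + (a ⊔ b) ≡ a + b
min+max a b with ≤-total a b
... | inj₁ a≤b rewrite m≤n⇒m⊓n≡m a≤b | m≤n⇒m⊔n≡n a≤b = refl
... | inj₂ b≤a rewrite m≥n⇒m⊓n≡n b≤a | m≥n⇒m⊔n≡m b≤a = +-comm b a

move-decreases : ∀ {a b p} → Move a b p → size p < a + b
move-decreases {a} {b} (takeˡ t t<a) = +-monoˡ-< b (∸-suc-< t<a)
move-decreases {a} {b} (takeʳ t t<b) = +-monoʳ-< a (∸-suc-< t<b)
move-decreases {a} {b} (takeᵈ t t<m) = +-mono-<-≤ (∸-suc-< (≤-trans t<m (m⊓n≤m a b))) (m∸n≤m b (suc t))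
move-decreases {a} {b} (takeᴱ k l k<m _) =
  subst ((a ⊓ b) ∸ suc k + ((a ⊔ b) ∸ l) <_) (min+max a b) (+-mono-<-≤ (∸-suc-< k<m) (m∸n≤m (a ⊔ b) l))

grundyF-stable : ∀ f g a b → a + b < f → a + b < g → grundyF f a b ≡ grundyF g a b
grundyF-stable (suc f) (suc g) a b a+b<f a+b<g = cong mex (map-cong-local (All.tabulate λ {p} p∈ →
  let p<ab = move-decreases (∈⇒move a b p∈) in
  grundyF-stable f g (proj₁ p) (proj₂ p) (<-≤-trans p<ab (s≤s⁻¹ a+b<f)) (<-≤-trans p<ab (s≤s⁻¹ a+b<g))))

G : Pos → ℕ
G p = GE (proj₁ p) (proj₂ p)

GE-unfold : ∀ a b → GE a b ≡ mex (map G (moves a b))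
GE-unfold a b = cong mex (map-cong-local (All.tabulate λ {p} p∈ →
  grundyF-stable (a + b) (suc (size p)) (proj₁ p) (proj₂ p) (move-decreases (∈⇒move a b p∈)) ≤-refl))

OptionValue : ℕ → ℕ → ℕ → Set
OptionValue a b k = Σ Pos λ p → p ∈ moves a b × G p ≡ k

option-≢ : ∀ a b {p} → p ∈ moves a b → G p ≢ GE a b
option-≢ a b {p} p∈ Gp≡ = proj₂ (mex-isMex (map G (moves a b)))
  (subst (_∈ map G (moves a b)) (trans Gp≡ (GE-unfold a b)) (∈-map⁺ G p∈))

below-attained : ∀ a b {w} → w < GE a b → OptionValue a b w
below-attained a b {w} w<
  with p , p∈ , w≡ ← ∈-map⁻ G (proj₁ (mex-isMex (map G (moves a b))) (subst (w <_) (GE-unfold a b) w<))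
  = p , p∈ , sym w≡

GE-char : ∀ a b m → (∀ p → p ∈ moves a b → G p ≢ m) → (∀ k → k < m → OptionValue a b k) → GE a b ≡ m
GE-char a b m avoids attains with <-cmp (GE a b) m
... | tri≈ _ e _ = e
... | tri< lt _ _ with p , p∈ , Gp≡ ← attains (GE a b) lt = ⊥-elim (option-≢ a b p∈ Gp≡)
... | tri> _ _ gt with p , p∈ , Gp≡ ← below-attained a b gt = ⊥-elim (avoids p p∈ Gp≡)

row-option : ∀ a {b z} → z < b → (a , z) ∈ moves a b
row-option a {suc b} {z} (s≤s z≤b) =
  subst (λ x → (a , x) ∈ moves a (suc b)) (m∸[m∸n]≡n z≤b) (move⇒∈ (takeʳ (b ∸ z) (s≤s (m∸n≤m b z))))

data RowOption (a j : ℕ) : Pos → Set where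
  same-row  : ∀ {z} → z < j → RowOption a j (a , z)
  lower-row : ∀ {i z} → i < a → j + i ≤ z + a → z ≤ j → RowOption a j (i , z)

∸-balance : ∀ {t a j} → t ≤ a → t ≤ j → j + (a ∸ t) ≡ (j ∸ t) + a
∸-balance {zero}              _         _         = refl
∸-balance {suc t} {suc a} {suc j} (s≤s t≤a) (s≤s t≤j) =
  trans (cong suc (∸-balance t≤a t≤j)) (sym (+-suc (j ∸ t) a))

classify : ∀ {a j p} → a ≤ j → p ∈ moves a j → RowOption a j p
classify {a} {j} a≤j p∈ with ∈⇒move a j p∈
... | takeˡ t t<a = lower-row (∸-suc-< t<a) (+-monoʳ-≤ j (m∸n≤m a (suc t))) ≤-refl
... | takeʳ t t<j = same-row (∸-suc-< t<j)
... | takeᵈ t t<m =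
  let t<a = subst (t <_) (m≤n⇒m⊓n≡m a≤j) t<m in
  lower-row (∸-suc-< t<a) (≤-reflexive (∸-balance t<a (≤-trans t<a a≤j))) (m∸n≤m j (suc t))
... | takeᴱ k l k<m l≤k rewrite m≤n⇒m⊓n≡m a≤j | m≤n⇒m⊔n≡n a≤j =
  lower-row (∸-suc-< k<m)
    (≤-trans (≤-reflexive (∸-balance k<m (≤-trans k<m a≤j))) (+-monoˡ-≤ a (∸-monoʳ-≤ j (m≤n⇒m≤1+n l≤k))))
    (m∸n≤m j l)

avoid-by-rows : ∀ {a j m} → a ≤ j →
  (∀ z → z < j → GE a z ≢ m) →
  (∀ i z → i < a → j + i ≤ z + a → z ≤ j → GE i z ≢ m) →
  ∀ p → p ∈ moves a j → G p ≢ m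
avoid-by-rows a≤j same lower p p∈ with classify a≤j p∈
... | same-row z<j           = same _ z<j
... | lower-row i<a near z≤j = lower _ _ i<a near z≤j

GE-row0 : ∀ z → GE 0 z ≡ z
GE-row0 = <-rec _ λ z ih → GE-char 0 z z
  (avoid-by-rows z≤n (λ z′ z′<z e → <⇒≢ z′<z (trans (sym (ih z′<z)) e)) (λ _ _ ()))
  (λ k k<z → (0 , k) , row-option 0 k<z , ih k<z)

-- Row 1: G(1,·) = 1, 2, 0, 4, 5, 3, 7, 8, 6, ..., i.e. 1, 2, 0 shifted by 3
-- every 3 steps; `row1⁻¹` is its inverse permutation.

row1 row1⁻¹ : ℕ → ℕ
row1 0 = 1
row1 1 = 2
row1 2 = 0
row1 (suc (suc (suc n))) = 3 + row1 n
row1⁻¹ 0 = 2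
row1⁻¹ 1 = 0
row1⁻¹ 2 = 1
row1⁻¹ (suc (suc (suc n))) = 3 + row1⁻¹ n

row1-inverseˡ : ∀ k → row1 (row1⁻¹ k) ≡ k
row1-inverseˡ 0 = refl
row1-inverseˡ 1 = refl
row1-inverseˡ 2 = refl
row1-inverseˡ (suc (suc (suc k))) = cong (3 +_) (row1-inverseˡ k)

row1-inverseʳ : ∀ k → row1⁻¹ (row1 k) ≡ k
row1-inverseʳ 0 = refl
row1-inverseʳ 1 = refl
row1-inverseʳ 2 = refl
row1-inverseʳ (suc (suc (suc k))) = cong (3 +_) (row1-inverseʳ k)

row1-offset : ∀ y → row1 y ≡ suc y ⊎ row1 y + 2 ≡ y
row1-offset 0 = inj₁ refl
row1-offset 1 = inj₁ refl
row1-offset 2 = inj₂ refl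
row1-offset (suc (suc (suc y))) with row1-offset y
... | inj₁ e = inj₁ (cong (3 +_) e)
... | inj₂ e = inj₂ (cong (3 +_) e)

row1-below : ∀ y k → k < row1 y → row1⁻¹ k < y ⊎ k ≡ y ⊎ suc k ≡ y
row1-below 0 0 _ = inj₂ (inj₁ refl)
row1-below 1 0 _ = inj₂ (inj₂ refl)
row1-below 1 1 _ = inj₂ (inj₁ refl)
row1-below (suc (suc (suc m))) 0 _ = inj₁ (s≤s (s≤s (s≤s z≤n)))
row1-below (suc (suc (suc m))) 1 _ = inj₁ (s≤s z≤n)
row1-below (suc (suc (suc m))) 2 _ = inj₁ (s≤s (s≤s z≤n))
row1-below (suc (suc (suc m))) (suc (suc (suc k))) (s≤s (s≤s (s≤s lt))) with row1-below m k lt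
... | inj₁ x        = inj₁ (s≤s (s≤s (s≤s x)))
... | inj₂ (inj₁ e) = inj₂ (inj₁ (cong (3 +_) e))
... | inj₂ (inj₂ e) = inj₂ (inj₂ (cong (3 +_) e))
row1-below 0 (suc k) (s≤s ())
row1-below 1 (suc (suc k)) (s≤s (s≤s ()))
row1-below 2 k ()

GE-row1 : ∀ y → GE 1 y ≡ row1 y
GE-row1 = <-rec _ step
  where
  step : ∀ y → (∀ {z} → z < y → GE 1 z ≡ row1 z) → GE 1 y ≡ row1 y
  step zero    _  = refl
  step (suc y) ih = GE-char 1 Y (row1 Y) (avoid-by-rows (s≤s z≤n) same lower) attains
    where
    Y = suc y
    same : ∀ z → z < Y → GE 1 z ≢ row1 Y
    same z z<Y e = <⇒≢ z<Y (begin
      z                 ≡⟨ sym (row1-inverseʳ z) ⟩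
      row1⁻¹ (row1 z)   ≡⟨ cong row1⁻¹ (trans (sym (ih z<Y)) e) ⟩
      row1⁻¹ (row1 Y)   ≡⟨ row1-inverseʳ Y ⟩
      Y                 ∎)
      where open ≡-Reasoning
    lower : ∀ i z → i < 1 → Y + i ≤ z + 1 → z ≤ Y → GE i z ≢ row1 Y
    lower zero z _ near z≤Y e with row1-offset Y | trans (sym (GE-row0 z)) e
    ... | inj₁ r≡ | z≡ = 1+n≰n (subst (_≤ Y) (trans z≡ r≡) z≤Y)
    ... | inj₂ r≡ | z≡ =
      1+n≰n (subst₂ _≤_ (trans (+-identityʳ Y) (trans (sym r≡) (+-suc (row1 Y) 1))) (cong (_+ 1) z≡) near)
    lower (suc _) _ (s≤s ()) _ _ _
    attains : ∀ k → k < row1 Y → OptionValue 1 Y k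
    attains k k< with row1-below Y k k<
    ... | inj₁ h = (1 , row1⁻¹ k) , row-option 1 h , trans (ih h) (row1-inverseˡ k)
    ... | inj₂ (inj₁ refl) = (0 , Y) , move⇒∈ (takeˡ 0 (s≤s z≤n)) , GE-row0 Y
    ... | inj₂ (inj₂ refl) = (0 , k) , move⇒∈ (takeᵈ 0 (s≤s z≤n)) , GE-row0 k

-- Row 2: G(2,0) = 2, G(2,1) = 0 and G(2, n + 2) = row2-tail n, where
-- row2-tail = 3, 5, 1, 6, 8, 4, ... is 3, 5, 1 shifted by 3 every 3 steps;
-- `row2⁻¹` is the inverse permutation of `row2`.

row2-tail row2-tail⁻¹ row2 row2⁻¹ : ℕ → ℕ
row2-tail 0 = 3
row2-tail 1 = 5
row2-tail 2 = 1
row2-tail (suc (suc (suc n))) = 3 + row2-tail n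
row2-tail⁻¹ 0 = 0
row2-tail⁻¹ 1 = 5
row2-tail⁻¹ 2 = 1
row2-tail⁻¹ (suc (suc (suc n))) = 3 + row2-tail⁻¹ n
row2 0 = 2
row2 1 = 0
row2 (suc (suc n)) = row2-tail n
row2⁻¹ 0 = 1
row2⁻¹ 1 = 4
row2⁻¹ 2 = 0
row2⁻¹ (suc (suc (suc n))) = 2 + row2-tail⁻¹ n

row2-tail-inverseˡ : ∀ n → row2-tail (row2-tail⁻¹ n) ≡ 3 + n
row2-tail-inverseˡ 0 = refl
row2-tail-inverseˡ 1 = refl
row2-tail-inverseˡ 2 = refl
row2-tail-inverseˡ (suc (suc (suc n))) = cong (3 +_) (row2-tail-inverseˡ n)

row2-tail-inverseʳ : ∀ n → row2-tail⁻¹ (row2-tail n) ≡ 3 + n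
row2-tail-inverseʳ 0 = refl
row2-tail-inverseʳ 1 = refl
row2-tail-inverseʳ 2 = refl
row2-tail-inverseʳ (suc (suc (suc n))) = cong (3 +_) (row2-tail-inverseʳ n)

row2-inverseˡ : ∀ k → row2 (row2⁻¹ k) ≡ k
row2-inverseˡ 0 = refl
row2-inverseˡ 1 = refl
row2-inverseˡ 2 = refl
row2-inverseˡ (suc (suc (suc n))) = row2-tail-inverseˡ n

row2-inverseʳ : ∀ y → row2⁻¹ (row2 y) ≡ y
row2-inverseʳ 0 = refl
row2-inverseʳ 1 = refl
row2-inverseʳ 2 = refl
row2-inverseʳ 3 = refl
row2-inverseʳ 4 = refl
row2-inverseʳ (suc (suc (suc (suc (suc n))))) = cong (2 +_) (row2-tail-inverseʳ n)

row2-offset : ∀ n → row2-tail n ≡ 3 + n ⊎ row2-tail n ≡ 4 + n ⊎ suc (row2-tail n) ≡ n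
row2-offset 0 = inj₁ refl
row2-offset 1 = inj₂ (inj₁ refl)
row2-offset 2 = inj₂ (inj₂ refl)
row2-offset (suc (suc (suc n))) with row2-offset n
... | inj₁ e        = inj₁ (cong (3 +_) e)
... | inj₂ (inj₁ e) = inj₂ (inj₁ (cong (3 +_) e))
... | inj₂ (inj₂ e) = inj₂ (inj₂ (cong (3 +_) e))

3+-injective : ∀ {m n} → 3 + m ≡ 3 + n → m ≡ n
3+-injective refl = refl

row1-≢-row2-tail : ∀ n → row1 (suc n) ≢ row2-tail n
row1-≢-row2-tail 0 ()
row1-≢-row2-tail 1 ()
row1-≢-row2-tail 2 ()
row1-≢-row2-tail (suc (suc (suc n))) e = row1-≢-row2-tail n (3+-injective e)

row1-≢-row2-tail′ : ∀ n → row1 (suc (suc n)) ≢ row2-tail n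
row1-≢-row2-tail′ 0 ()
row1-≢-row2-tail′ 1 ()
row1-≢-row2-tail′ 2 ()
row1-≢-row2-tail′ (suc (suc (suc n))) e = row1-≢-row2-tail′ n (3+-injective e)

row2-below : ∀ n k → k < row2-tail n →
  row2⁻¹ k < 2 + n ⊎ k ≡ n ⊎ k ≡ suc n ⊎ k ≡ suc (suc n) ⊎ k ≡ row1 (2 + n)
row2-below 0 0 _ = inj₁ (s≤s (s≤s z≤n))
row2-below 0 1 _ = inj₂ (inj₂ (inj₁ refl))
row2-below 0 2 _ = inj₁ (s≤s z≤n)
row2-below 1 0 _ = inj₁ (s≤s (s≤s z≤n))
row2-below 1 1 _ = inj₂ (inj₁ refl)
row2-below 1 2 _ = inj₁ (s≤s z≤n)
row2-below 1 3 _ = inj₂ (inj₂ (inj₂ (inj₁ refl)))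
row2-below 1 4 _ = inj₂ (inj₂ (inj₂ (inj₂ refl)))
row2-below 2 0 _ = inj₁ (s≤s (s≤s z≤n))
row2-below (suc (suc (suc m))) 0 _ = inj₁ (s≤s (s≤s z≤n))
row2-below (suc (suc (suc m))) 1 _ = inj₁ (s≤s (s≤s (s≤s (s≤s (s≤s z≤n)))))
row2-below (suc (suc (suc m))) 2 _ = inj₁ (s≤s z≤n)
row2-below (suc (suc (suc m))) 3 _ = inj₁ (s≤s (s≤s (s≤s z≤n)))
row2-below 3 4 _ = inj₂ (inj₂ (inj₁ refl))
row2-below 4 4 _ = inj₂ (inj₁ refl)
row2-below 5 4 (s≤s (s≤s (s≤s (s≤s ()))))
row2-below (suc (suc (suc (suc (suc (suc m)))))) 4 _ = inj₁ (s≤s (s≤s (s≤s (s≤s (s≤s (s≤s (s≤s (s≤s z≤n))))))))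
row2-below (suc (suc (suc m))) 5 _ = inj₁ (s≤s (s≤s (s≤s (s≤s z≤n))))
row2-below (suc (suc (suc m))) (suc (suc (suc (suc (suc (suc k)))))) (s≤s (s≤s (s≤s lt))) with row2-below m (3 + k) lt
... | inj₁ x                      = inj₁ (s≤s (s≤s (s≤s x)))
... | inj₂ (inj₁ e)               = inj₂ (inj₁ (cong (3 +_) e))
... | inj₂ (inj₂ (inj₁ e))        = inj₂ (inj₂ (inj₁ (cong (3 +_) e)))
... | inj₂ (inj₂ (inj₂ (inj₁ e))) = inj₂ (inj₂ (inj₂ (inj₁ (cong (3 +_) e))))
... | inj₂ (inj₂ (inj₂ (inj₂ e))) = inj₂ (inj₂ (inj₂ (inj₂ (cong (3 +_) e))))
row2-below 0 (suc (suc (suc k))) (s≤s (s≤s (s≤s ())))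
row2-below 1 (suc (suc (suc (suc (suc k))))) (s≤s (s≤s (s≤s (s≤s (s≤s ())))))
row2-below 2 (suc k) (s≤s ())

row1-neighbours : ∀ n z → 2 + n + 1 ≤ z + 2 → z ≤ 2 + n → z ≡ suc n ⊎ z ≡ 2 + n
row1-neighbours n z near z≤ with m≤n⇒m<n∨m≡n z≤
... | inj₂ e   = inj₂ e
... | inj₁ z<  = inj₁ (≤-antisym (s≤s⁻¹ z<) (+-cancelʳ-≤ 2 (suc n) z (subst (_≤ z + 2) (cong suc (sym (+-suc n 1))) near)))

GE-row2 : ∀ y → GE 2 y ≡ row2 y
GE-row2 = <-rec _ step
  where
  step : ∀ y → (∀ {z} → z < y → GE 2 z ≡ row2 z) → GE 2 y ≡ row2 y
  step 0 _ = refl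
  step 1 _ = refl
  step (suc (suc n)) ih = GE-char 2 Y (row2 Y) (avoid-by-rows (s≤s (s≤s z≤n)) same lower) attains
    where
    Y = suc (suc n)
    same : ∀ z → z < Y → GE 2 z ≢ row2 Y
    same z z<Y e = <⇒≢ z<Y (begin
      z                 ≡⟨ sym (row2-inverseʳ z) ⟩
      row2⁻¹ (row2 z)   ≡⟨ cong row2⁻¹ (trans (sym (ih z<Y)) e) ⟩
      row2⁻¹ (row2 Y)   ≡⟨ row2-inverseʳ Y ⟩
      Y                 ∎)
      where open ≡-Reasoning
    lower : ∀ i z → i < 2 → Y + i ≤ z + 2 → z ≤ Y → GE i z ≢ row2 Y
    lower 0 z _ near z≤Y e with row2-offset n | trans (sym (GE-row0 z)) e
    ... | inj₁ r≡        | z≡ = 1+n≰n (subst (_≤ Y) (trans z≡ r≡) z≤Y)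
    ... | inj₂ (inj₁ r≡) | z≡ = 1+n≰n (m≤n⇒m≤1+n (subst (_≤ Y) (trans z≡ r≡) z≤Y))
    ... | inj₂ (inj₂ r≡) | z≡ = 1+n≰n (subst (_≤ row2 Y) (sym r≡) (+-cancelʳ-≤ 2 n (row2 Y) near′))
      where
      near′ : n + 2 ≤ row2 Y + 2
      near′ = subst₂ _≤_ (trans (+-identityʳ Y) (+-comm 2 n)) (cong (_+ 2) z≡) near
    lower 1 z _ near z≤Y e with row1-neighbours n z near z≤Y
    ... | inj₁ refl = row1-≢-row2-tail n (trans (sym (GE-row1 z)) e)
    ... | inj₂ refl = row1-≢-row2-tail′ n (trans (sym (GE-row1 z)) e)
    lower (suc (suc _)) _ (s≤s (s≤s ())) _ _ _
    attains : ∀ k → k < row2 Y → OptionValue 2 Y k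
    attains k k< with row2-below n k k<
    ... | inj₁ h = (2 , row2⁻¹ k) , row-option 2 h , trans (ih h) (row2-inverseˡ k)
    ... | inj₂ (inj₁ refl)               = (0 , n) , move⇒∈ (takeᵈ 1 (s≤s (s≤s z≤n))) , GE-row0 n
    ... | inj₂ (inj₂ (inj₁ refl))        = (0 , suc n) , move⇒∈ (takeᴱ 1 1 (s≤s (s≤s z≤n)) (s≤s z≤n)) , GE-row0 (suc n)
    ... | inj₂ (inj₂ (inj₂ (inj₁ refl))) = (0 , Y) , move⇒∈ (takeˡ 1 (s≤s (s≤s z≤n))) , GE-row0 Y
    ... | inj₂ (inj₂ (inj₂ (inj₂ refl))) = (1 , Y) , move⇒∈ (takeˡ 0 (s≤s z≤n)) , GE-row1 Y

row1-lower-bound : ∀ z → z ≤ row1 z + 2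
row1-lower-bound z with row1-offset z
... | inj₁ r≡ = subst (z ≤_) (cong (_+ 2) (sym r≡)) (≤-trans (n≤1+n z) (m≤m+n (suc z) 2))
... | inj₂ r≡ = ≤-reflexive (sym r≡)

row2-lower-bound : ∀ z → z ≤ row2 z + 3
row2-lower-bound 0 = z≤n
row2-lower-bound 1 = s≤s z≤n
row2-lower-bound (suc (suc n)) with row2-offset n
... | inj₁ r≡        = subst (2 + n ≤_) (cong (_+ 3) (sym r≡)) (≤-trans (m≤n+m (2 + n) 1) (m≤m+n (3 + n) 3))
... | inj₂ (inj₁ r≡)  = subst (2 + n ≤_) (cong (_+ 3) (sym r≡)) (≤-trans (m≤n+m (2 + n) 2) (m≤m+n (4 + n) 3))
... | inj₂ (inj₂ r≡)  = ≤-reflexive (trans (cong (2 +_) (sym r≡)) (+-comm 3 (row2-tail n)))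

small-row-bound : ∀ i z → i < 3 → z ≤ GE i z + suc i
small-row-bound 0 z _ = subst (z ≤_) (cong (_+ 1) (sym (GE-row0 z))) (m≤m+n z 1)
small-row-bound 1 z _ = subst (z ≤_) (cong (_+ 2) (sym (GE-row1 z))) (row1-lower-bound z)
small-row-bound 2 z _ = subst (z ≤_) (cong (_+ 3) (sym (GE-row2 z))) (row2-lower-bound z)
small-row-bound (suc (suc (suc _))) _ (s≤s (s≤s (s≤s ())))

Bounded : Pos → Set
Bounded (a , b) = 3 ≤ a → b < GE a b + (a + a)

size-rec : (P : Pos → Set) → (∀ p → (∀ {q} → size q < size p → P q) → P p) → ∀ p → P p
size-rec = All.wfRec (On.wellFounded size <-wellFounded) 0ℓ

lower-row-slack : ∀ {a i z} → 3 ≤ a → i < a → Bounded (i , z) → z + 2 ≤ GE i z + (i + a)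
lower-row-slack {a} {i} {z} 3≤a i<a row-i-bounded with i <? 3
... | yes i<3 = begin
  z + 2                 ≤⟨ +-monoˡ-≤ 2 (small-row-bound i z i<3) ⟩
  GE i z + suc i + 2    ≡⟨ regroup (GE i z) i ⟩
  GE i z + (i + 3)      ≤⟨ +-monoʳ-≤ (GE i z) (+-monoʳ-≤ i 3≤a) ⟩
  GE i z + (i + a)      ∎
  where
  open ≤-Reasoning
  regroup : ∀ g k → g + suc k + 2 ≡ g + (k + 3)
  regroup = solve-∀
... | no i≮3 = begin
  z + 2                     ≡⟨ +-comm z 2 ⟩
  suc (suc z)               ≤⟨ s≤s (row-i-bounded (≮⇒≥ i≮3)) ⟩
  suc (GE i z + (i + i))    ≡⟨ regroup (GE i z) i ⟩
  GE i z + (i + suc i)      ≤⟨ +-monoʳ-≤ (GE i z) (+-monoʳ-≤ i i<a) ⟩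
  GE i z + (i + a)          ∎
  where
  open ≤-Reasoning
  regroup : ∀ g k → suc (g + (k + k)) ≡ g + (k + suc k)
  regroup = solve-∀

descend : ∀ {a j b} → a ≤ j → j < b → GE a b < GE a j →
  ∃₂ λ i z → i < a × j + i ≤ z + a × z ≤ j × GE i z ≡ GE a b
descend {a} {j} {b} a≤j j<b w<
  with p , p∈ , Gp≡ ← below-attained a j w<
  with classify a≤j p∈
... | same-row z<j           = ⊥-elim (option-≢ a b (row-option a (<-trans z<j j<b)) Gp≡)
... | lower-row i<a near z≤j = _ , _ , i<a , near , z≤j , Gp≡

gap-clash : ∀ {w a i j z} → suc j ≡ w + (a + a) → j + i ≤ z + a → z + 2 ≤ w + (i + a) → ⊥
gap-clash {w} {a} {i} {j} {z} j≡ near slack = 1+n≰n (begin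
  suc (suc (z + a))   ≡⟨ solve (z ∷ a ∷ []) ⟩
  z + 2 + a           ≤⟨ +-monoˡ-≤ a slack ⟩
  w + (i + a) + a     ≡⟨ solve (w ∷ i ∷ a ∷ []) ⟩
  w + (a + a) + i     ≡⟨ cong (_+ i) (sym j≡) ⟩
  suc (j + i)         ≤⟨ s≤s near ⟩
  suc (z + a)         ∎)
  where open ≤-Reasoning

no-gap : ∀ {a b} → 3 ≤ a → GE a b + (a + a) ≤ b → (∀ {q} → size q < a + b → Bounded q) → ⊥
no-gap {suc a′} {b} 3≤a gap ih = clash (descend a≤j j<b w<Gj)
  where
  a = suc a′
  w = GE a b
  j = w + (a + a′)
  j≡ : suc j ≡ w + (a + a)
  j≡ = sym (trans (cong (w +_) (+-suc a a′)) (+-suc w (a + a′)))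
  j<b : j < b
  j<b = subst (_≤ b) (sym j≡) gap
  a≤j : a ≤ j
  a≤j = ≤-trans (m≤m+n a a′) (m≤n+m (a + a′) w)
  w≤Gj : w ≤ GE a j
  w≤Gj = +-cancelʳ-≤ (a + a) w (GE a j)
    (subst (_≤ GE a j + (a + a)) j≡ (ih (+-monoʳ-< a j<b) 3≤a))
  w<Gj : w < GE a j
  w<Gj = ≤∧≢⇒< w≤Gj (λ e → option-≢ a b (row-option a j<b) (sym e))
  clash : ∃₂ (λ i z → i < a × j + i ≤ z + a × z ≤ j × GE i z ≡ w) → ⊥
  clash (i , z , i<a , near , z≤j , Giz≡w) = gap-clash j≡ near (subst (λ v → z + 2 ≤ v + (i + a)) Giz≡w
    (lower-row-slack 3≤a i<a (ih (+-mono-<-≤ i<a (≤-trans z≤j (<⇒≤ j<b))))))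

bounded : ∀ p → Bounded p
bounded = size-rec Bounded step
  where
  step : ∀ p → (∀ {q} → size q < size p → Bounded q) → Bounded p
  step (a , b) ih 3≤a with b <? GE a b + (a + a)
  ... | yes b< = b<
  ... | no  b≮ = ⊥-elim (no-gap 3≤a (≮⇒≥ b≮) ih)

-- Theorem 3.7: for 3 ≤ a ≤ b, G(a,b) ≥ b + 1 - 2a.
theorem3p7 : (a b : ℕ) → 3 ≤ a → a ≤ b → b + 1 ∸ 2 * a ≤ GE a b
theorem3p7 a b 3≤a _ = m≤n+o⇒m∸n≤o (b + 1) (2 * a) (begin
  b + 1              ≡⟨ +-comm b 1 ⟩
  suc b              ≤⟨ bounded (a , b) 3≤a ⟩
  GE a b + (a + a)   ≡⟨ +-comm (GE a b) (a + a) ⟩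
  (a + a) + GE a b   ≡⟨ cong (λ x → (a + x) + GE a b) (sym (+-identityʳ a)) ⟩
  2 * a + GE a b     ∎)
  where open ≤-Reasoning
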